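{- Let $\lambda=(\lambda_1<\dots<\lambda_t)\in\overline{\mathcal{U}}_N$ for some $N$, and suppose $\lambda_t$ is odd. Then for every integer $x$ with $1\le x\le\lambda_t-1$, $x$ is a part of $\lambda$ if and only if $\lambda_t-x$ is not a part of $\lambda$.
   Context: A partition of $N$ into distinct parts is $\lambda=(\lambda_1<\dots<\lambda_t)$, $t\ge2$, positive integers summing to $N$. Missing parts: $\mathcal{M}_\lambda=\{1,\dots,\lambda_t\}\setminus\{\lambda_1,\dots,\lambda_t\}$. $\lambda$ is unrefinable if no two distinct missing parts sum to a part of $\lambda$. Maximal: its largest part is the maximum of the largest parts of unrefinable partitions of $N$. $\overline{\mathcal{U}}_N$ is the set of maximal unrefinable partitions $\lambda$ of $N$ with $\#\mathcal{M}_\lambda=\lfloor\lambda_t/2\rfloor$. -}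

module Defs where

open import Data.Nat using (ℕ; zero; suc; _+_; _≤_; _<_; _⊔_; _/_)
open import Data.Nat.Properties using (_≟_)
open import Data.Nat.ListAction using (sum)
open import Data.List using (List; length; foldr; filter; map; upTo)
open import Data.List.Relation.Unary.All using (All)
open import Data.List.Relation.Unary.Linked using (Linked)
open import Data.List.Membership.Propositional using (_∈_; _∉_)
open import Data.List.Membership.DecPropositional _≟_ using (_∈?_)
open import Data.Product using (_×_)
open import Relation.Binary.PropositionalEquality using (_≡_; _≢_)
open import Relation.Nullary using (¬_; ¬?)


IsDistinctPartition : ℕ → List ℕ → Set
IsDistinctPartition N ps =
  Linked _<_ ps × All (λ p → 1 ≤ p) ps × 2 ≤ length ps × sum ps ≡ N

-- Largest part λₜ (for a strictly increasing list this is its last entry).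
largest : List ℕ → ℕ
largest = foldr _⊔_ 0

IsMissing : List ℕ → ℕ → Set
IsMissing ps m = 1 ≤ m × m ≤ largest ps × m ∉ ps

Unrefinable : List ℕ → Set
Unrefinable ps =
  ∀ a b → a ≢ b → IsMissing ps a → IsMissing ps b → ¬ (a + b ∈ ps)

MaximalUnrefinable : ℕ → List ℕ → Set
MaximalUnrefinable N ps =
  IsDistinctPartition N ps × Unrefinable ps ×
  (∀ μ → IsDistinctPartition N μ → Unrefinable μ → largest μ ≤ largest ps)

missingParts : List ℕ → List ℕ
missingParts ps = filter (λ m → ¬? (m ∈? ps)) (map suc (upTo (largest ps)))

InUbar : ℕ → List ℕ → Set
InUbar N ps = MaximalUnrefinable N ps × length (missingParts ps) ≡ largest ps / 2

{-# OPTIONS --safe #-}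

-- Write λₜ = 2k + 1. The numbers 1, …, 2k split into the k complementary pairs
-- {x, λₜ − x}, whose members are distinct because λₜ is odd. As λₜ is a part,
-- unrefinability forbids both members of a pair from being missing, so the k
-- missing parts occupy k distinct pairs: every pair contains exactly one
-- missing part, which is the claim.

module Submission where

open import Defs
open import Data.Bool using (true; false; if_then_else_)
open import Data.List using (List; length; filter; applyUpTo)
open import Data.List.Properties using (map-applyUpTo)
open import Data.List.Membership.Propositional using (_∈_)
open import Data.List.Membership.Propositional.Properties using (foldr-selective)
open import Data.Nat using (ℕ; zero; suc; _+_; _*_; _⊔_; _≤_; _<_; _∸_; _%_; _/_; z≤n; s≤s; pred)
open import Data.Nat.Properties
open import Data.Nat.DivMod using (m≡m%n+[m/n]*n)
open import Data.List.Membership.DecPropositional _≟_ using (_∈?_)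
open import Data.Product using (_,_)
open import Data.Sum using (_⊎_; inj₁; inj₂; [_,_]′)
open import Function using (_∘_; id)
open import Function.Bundles using (_⇔_; mk⇔)
open import Relation.Binary.PropositionalEquality using (_≡_; _≢_; refl; sym; trans; cong; cong₂; subst; module ≡-Reasoning)
open import Relation.Nullary using (¬_; ¬?; Dec; does; yes; no; contradiction)
open import Relation.Unary using (Pred; Decidable)

∑ : ℕ → (ℕ → ℕ) → ℕ
∑ zero    f = 0
∑ (suc n) f = f 0 + ∑ n (f ∘ suc)

∑-suc : ∀ n f → ∑ (suc n) f ≡ ∑ n f + f n
∑-suc zero    f = +-comm (f 0) 0
∑-suc (suc n) f = begin
  f 0 + ∑ (suc n) (f ∘ suc)           ≡⟨ cong (f 0 +_) (∑-suc n (f ∘ suc)) ⟩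
  f 0 + (∑ n (f ∘ suc) + f (suc n))   ≡⟨ +-assoc (f 0) _ _ ⟨
  ∑ (suc n) f + f (suc n)             ∎
  where open ≡-Reasoning

∑-ends : ∀ n f → ∑ (suc n + suc n) f ≡ (f 0 + f (suc (n + n))) + ∑ (n + n) (f ∘ suc)
∑-ends n f = begin
  ∑ (suc n + suc n) f                            ≡⟨ cong (λ m → ∑ (suc m) f) (+-suc n n) ⟩
  f 0 + ∑ (suc (n + n)) (f ∘ suc)                ≡⟨ cong (f 0 +_) (∑-suc (n + n) (f ∘ suc)) ⟩
  f 0 + (∑ (n + n) (f ∘ suc) + f (suc (n + n)))  ≡⟨ cong (f 0 +_) (+-comm (∑ (n + n) (f ∘ suc)) _) ⟩
  f 0 + (f (suc (n + n)) + ∑ (n + n) (f ∘ suc))  ≡⟨ +-assoc (f 0) _ _ ⟨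
  (f 0 + f (suc (n + n))) + ∑ (n + n) (f ∘ suc)  ∎
  where open ≡-Reasoning

MirrorAtMostOne : ℕ → (ℕ → ℕ) → Set
MirrorAtMostOne n f = ∀ i j → suc (i + j) ≡ n + n → f i + f j ≤ 1

mirror-suc⁻ : ∀ {i j n} → suc (suc i + suc j) ≡ suc n + suc n → suc (i + j) ≡ n + n
mirror-suc⁻ {i} {j} {n} e =
  suc-injective (trans (sym (cong suc (+-suc i j))) (trans (suc-injective e) (+-suc n n)))

mirror-suc⁺ : ∀ {i j n} → suc (i + j) ≡ n + n → suc (suc i + suc j) ≡ suc n + suc n
mirror-suc⁺ {i} {j} {n} e =
  cong suc (trans (cong suc (+-suc i j)) (trans (cong suc e) (sym (+-suc n n))))

mirror-zero : ∀ {j n} → suc j ≡ suc n + suc n → j ≡ suc (n + n)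
mirror-zero {n = n} e = trans (suc-injective e) (+-suc n n)

MirrorAtMostOne-ends : ∀ {n} f → MirrorAtMostOne (suc n) f → f 0 + f (suc (n + n)) ≤ 1
MirrorAtMostOne-ends {n} f h = h 0 (suc (n + n)) (cong suc (sym (+-suc n n)))

MirrorAtMostOne-suc : ∀ {n} f → MirrorAtMostOne (suc n) f → MirrorAtMostOne n (f ∘ suc)
MirrorAtMostOne-suc f h i j e = h (suc i) (suc j) (mirror-suc⁺ e)

∑-mirror-≤ : ∀ n f → MirrorAtMostOne n f → ∑ (n + n) f ≤ n
∑-mirror-≤ zero    f h = z≤n
∑-mirror-≤ (suc n) f h = begin
  ∑ (suc n + suc n) f                            ≡⟨ ∑-ends n f ⟩
  (f 0 + f (suc (n + n))) + ∑ (n + n) (f ∘ suc)  ≤⟨ +-mono-≤ (MirrorAtMostOne-ends f h)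
                                                            (∑-mirror-≤ n (f ∘ suc) (MirrorAtMostOne-suc f h)) ⟩
  suc n                                          ∎
  where open ≤-Reasoning

∑-mirror-<-ends : ∀ n f → MirrorAtMostOne (suc n) f →
                  f 0 ≡ 0 → f (suc (n + n)) ≡ 0 → ∑ (suc n + suc n) f < suc n
∑-mirror-<-ends n f h f₀ f₁ = s≤s (begin
  ∑ (suc n + suc n) f                            ≡⟨ ∑-ends n f ⟩
  (f 0 + f (suc (n + n))) + ∑ (n + n) (f ∘ suc)  ≡⟨ cong₂ (λ a b → a + b + ∑ (n + n) (f ∘ suc)) f₀ f₁ ⟩
  ∑ (n + n) (f ∘ suc)                            ≤⟨ ∑-mirror-≤ n (f ∘ suc) (MirrorAtMostOne-suc f h) ⟩
  n                                              ∎)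
  where open ≤-Reasoning

∑-mirror-< : ∀ n f → MirrorAtMostOne n f →
             ∀ i j → suc (i + j) ≡ n + n → f i ≡ 0 → f j ≡ 0 → ∑ (n + n) f < n
∑-mirror-< (suc n) f h zero j e f₀ fⱼ =
  ∑-mirror-<-ends n f h f₀ (subst (λ m → f m ≡ 0) (mirror-zero e) fⱼ)
∑-mirror-< (suc n) f h (suc i) zero e fᵢ f₀ =
  ∑-mirror-<-ends n f h f₀ (subst (λ m → f m ≡ 0) (mirror-zero e′) fᵢ)
  where
  e′ : suc (suc i) ≡ suc n + suc n
  e′ = trans (cong suc (sym (+-identityʳ (suc i)))) e
∑-mirror-< (suc n) f h (suc i) (suc j) e fᵢ fⱼ = begin-strict
  ∑ (suc n + suc n) f                            ≡⟨ ∑-ends n f ⟩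
  (f 0 + f (suc (n + n))) + ∑ (n + n) (f ∘ suc)  <⟨ +-mono-≤-< (MirrorAtMostOne-ends f h)
                                                     (∑-mirror-< n (f ∘ suc) (MirrorAtMostOne-suc f h) i j (mirror-suc⁻ e) fᵢ fⱼ) ⟩
  suc n                                          ∎
  where open ≤-Reasoning

indicator : ∀ {p} {P : Set p} → Dec P → ℕ
indicator d = if does d then 1 else 0

indicator≤1 : ∀ {p} {P : Set p} (d : Dec P) → indicator d ≤ 1
indicator≤1 d with does d
... | true  = ≤-refl
... | false = z≤n

length-filter-applyUpTo : ∀ {a p} {A : Set a} {P : Pred A p} (P? : Decidable P) (f : ℕ → A) n →
                          length (filter P? (applyUpTo f n)) ≡ ∑ n (λ i → indicator (P? (f i)))
length-filter-applyUpTo P? f zero = refl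
length-filter-applyUpTo P? f (suc n) with does (P? (f 0))
... | true  = cong suc (length-filter-applyUpTo P? (f ∘ suc) n)
... | false = length-filter-applyUpTo P? (f ∘ suc) n

largest∈ : ∀ {ps} → largest ps ≢ 0 → largest ps ∈ ps
largest∈ {ps} L≢0 = [ (λ L≡0 → contradiction L≡0 L≢0) , id ]′ (foldr-selective {_•_ = _⊔_} ⊔-sel 0 ps)

odd⇒suc-double : ∀ {n} → n % 2 ≡ 1 → n ≡ suc (n / 2 + n / 2)
odd⇒suc-double {n} odd = begin
  n                          ≡⟨ m≡m%n+[m/n]*n n 2 ⟩
  n % 2 + n / 2 * 2          ≡⟨ cong₂ _+_ odd (*-comm (n / 2) 2) ⟩
  suc (n / 2 + (n / 2 + 0))  ≡⟨ cong (λ m → suc (n / 2 + m)) (+-identityʳ (n / 2)) ⟩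
  suc (n / 2 + n / 2)        ∎
  where open ≡-Reasoning

double≢odd : ∀ m n → m + m ≢ suc (n + n)
double≢odd m n e = even≢odd m n
  (trans (cong (m +_) (+-identityʳ m)) (trans e (cong (λ k → suc (n + k)) (sym (+-identityʳ n)))))

missingIndicator : List ℕ → ℕ → ℕ
missingIndicator ps m = indicator (¬? (m ∈? ps))

missingIndicator-∈ : ∀ {ps m} → m ∈ ps → missingIndicator ps m ≡ 0
missingIndicator-∈ {ps} {m} m∈ps with m ∈? ps
... | yes _   = refl
... | no m∉ps = contradiction m∈ps m∉ps

length-missingParts : ∀ ps → length (missingParts ps) ≡ ∑ (largest ps) (missingIndicator ps ∘ suc)
length-missingParts ps = trans
  (cong (length ∘ filter (λ m → ¬? (m ∈? ps))) (map-applyUpTo id suc (largest ps)))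
  (length-filter-applyUpTo (λ m → ¬? (m ∈? ps)) suc (largest ps))

unrefinable-complement : ∀ {ps a b} → Unrefinable ps → largest ps ∈ ps → a + b ≡ largest ps →
                         a ≢ b → 1 ≤ a → 1 ≤ b → a ∈ ps ⊎ b ∈ ps
unrefinable-complement {ps} {a} {b} unref L∈ps a+b≡L a≢b 1≤a 1≤b with a ∈? ps | b ∈? ps
... | yes a∈ps | _        = inj₁ a∈ps
... | no _     | yes b∈ps = inj₂ b∈ps
... | no a∉ps  | no b∉ps  = contradiction (subst (_∈ ps) (sym a+b≡L) L∈ps)
  (unref a b a≢b (1≤a , subst (a ≤_) a+b≡L (m≤m+n a b) , a∉ps) (1≤b , subst (b ≤_) a+b≡L (m≤n+m b a) , b∉ps))

missingIndicator-+≤1 : ∀ {ps a b} → a ∈ ps ⊎ b ∈ ps → missingIndicator ps a + missingIndicator ps b ≤ 1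
missingIndicator-+≤1 {ps} {a} {b} (inj₁ a∈ps)
  rewrite missingIndicator-∈ a∈ps = indicator≤1 (¬? (b ∈? ps))
missingIndicator-+≤1 {ps} {a} {b} (inj₂ b∈ps)
  rewrite missingIndicator-∈ b∈ps | +-identityʳ (missingIndicator ps a) = indicator≤1 (¬? (a ∈? ps))

module _ {ps : List ℕ} {k : ℕ} (unref : Unrefinable ps) (L≡ : largest ps ≡ suc (k + k)) where

  private
    -- Index i stands for the number i + 1, so mirror indices (i + j = 2k − 1)
    -- stand for complementary numbers (summing to λₜ = 2k + 1).
    missing : ℕ → ℕ
    missing i = missingIndicator ps (suc i)

    L∈ps : largest ps ∈ ps
    L∈ps = largest∈ (λ L≡0 → 1+n≢0 (trans (sym L≡) L≡0))

  complement∈ : ∀ {x y} → x + y ≡ largest ps → 1 ≤ x → 1 ≤ y → x ∈ ps ⊎ y ∈ ps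
  complement∈ {x} {y} x+y≡L = unrefinable-complement unref L∈ps x+y≡L x≢y
    where
    x≢y : x ≢ y
    x≢y refl = double≢odd x k (trans x+y≡L L≡)

  missing-mirror : MirrorAtMostOne k missing
  missing-mirror i j e = missingIndicator-+≤1
    (complement∈ (trans (cong suc (+-suc i j)) (trans (cong suc e) (sym L≡))) (s≤s z≤n) (s≤s z≤n))

  length-missingParts≡∑ : length (missingParts ps) ≡ ∑ (k + k) missing
  length-missingParts≡∑ = begin
    length (missingParts ps)              ≡⟨ length-missingParts ps ⟩
    ∑ (largest ps) missing                ≡⟨ cong (λ n → ∑ n missing) L≡ ⟩
    ∑ (suc (k + k)) missing               ≡⟨ ∑-suc (k + k) missing ⟩
    ∑ (k + k) missing + missing (k + k)   ≡⟨ cong (∑ (k + k) missing +_) missing-λₜ ⟩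
    ∑ (k + k) missing + 0                 ≡⟨ +-identityʳ _ ⟩
    ∑ (k + k) missing                     ∎
    where
    open ≡-Reasoning
    missing-λₜ : missing (k + k) ≡ 0
    missing-λₜ = missingIndicator-∈ (subst (_∈ ps) L≡ L∈ps)

  complement-⇔ : length (missingParts ps) ≡ k →
                 ∀ {x y} → x + y ≡ largest ps → 1 ≤ x → 1 ≤ y → (x ∈ ps) ⇔ (¬ (y ∈ ps))
  complement-⇔ #missing≡k {suc i} {suc j} x+y≡L 1≤x 1≤y = mk⇔
    (λ x∈ps y∈ps → <⇒≢
      (∑-mirror-< k missing missing-mirror i j e (missingIndicator-∈ x∈ps) (missingIndicator-∈ y∈ps))
      (trans (sym length-missingParts≡∑) #missing≡k))
    (λ y∉ps → [ id , (λ y∈ps → contradiction y∈ps y∉ps) ]′ (complement∈ x+y≡L 1≤x 1≤y))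
    where
    e : suc (i + j) ≡ k + k
    e = suc-injective (trans (sym (cong suc (+-suc i j))) (trans x+y≡L L≡))

lemma4p1 : (N : ℕ) (ps : List ℕ) → InUbar N ps → largest ps % 2 ≡ 1 →
    ∀ x → 1 ≤ x → x ≤ largest ps ∸ 1 → ((x ∈ ps) ⇔ (¬ (largest ps ∸ x ∈ ps)))
lemma4p1 _ ps ((_ , unref , _) , #missing≡k) odd x 1≤x x≤L∸1 =
  complement-⇔ unref L≡ #missing≡k (m+[n∸m]≡n (<⇒≤ x<L)) 1≤x (m<n⇒0<n∸m x<L)
  where
  L≡ : largest ps ≡ suc (largest ps / 2 + largest ps / 2)
  L≡ = odd⇒suc-double odd
  x<L : x < largest ps
  x<L = subst (x <_) (sym L≡) (s≤s (subst (λ n → x ≤ pred n) L≡ x≤L∸1))
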